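{- Let $1 \le i < n$. In the hierarchical blocking layout of a tree described in the context, consider any vertex $x$ and any traversal that starts at the copy of $x$ and follows tree edges down to a leaf of the copied subtree produced by $P_{i+1}(x)$. Such a traversal accesses at most $2 + B_i^{i+1}$ distinct aligned blocks of size $s_{i+1}$. That is, one may take $B_{i+1}^{i+1} = 2 + B_i^{i+1}$.
   Context: Memory hierarchy: there are $n$ levels with units of spatial locality (block sizes) $s_1 < s_2 < \dots < s_n$. Memory at level $j$ is partitioned into aligned blocks of $s_j$ bytes. Accessing a memory location at level $j$ means accessing the level-$j$ block that contains it. Tree: a rooted tree in which every non-root vertex has a unique parent and some number of children. Each vertex $v$ occupies $|v|$ bytes. Notation for algorithms: an algorithm $A$ applied to a vertex outputs a list of vertices. Applied to a list, $A$ is run on each vertex in order and the outputs are concatenated. $A^k$ means $A$ applied $k$ times, each application taking the previous output as input. $|A(I)|$ is the total size of all vertices processed by $A$ on input $I$. $\mathrm{BFS}_d(o)$ performs a bounded breadth-first search from $o$. It copies every vertex it traverses, in traversal order, into the next contiguous free memory, and outputs the list of vertices at distance exactly $d$ (in edges) from $o$. $P_1(o) = \mathrm{BFS}_d(o)$, where $d$ is chosen as follows. If $|\mathrm{BFS}_0(o)| > s_1$ then $d = 0$. Otherwise $d$ satisfies $|\mathrm{BFS}_{d-1}(o)| < s_1$ and $|\mathrm{BFS}_d(o)| \ge s_1$. For $i > 1$, $P_i(o) = P_{i-1}^k(o)$, where $k$ is chosen as follows. If $|P_{i-1}(o)| > s_i$ then $k = 1$. Otherwise $k$ satisfies $|P_{i-1}^{k-1}(o)|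 < s_i$ and $|P_{i-1}^{k}(o)| \ge s_i$. The tree is laid out by applying $P_n$ repeatedly, starting from the root, until the output list is empty. All copies are placed contiguously in the order they are made. $B_i^j$ denotes an upper bound, valid regardless of the start vertex $x$, on the number of level-$j$ blocks accessed by a traversal. The traversal starts at the copy of $x$ produced by $P_i(x)$ and ends at a leaf of the copied subtree produced by $P_i(x)$. -}

module Defs where

open import Data.Nat using (ℕ; zero; suc; _+_; _⊔_; _≤_; _<_; _≤?_; _≤ᵇ_; _/_)
open import Data.Nat.Properties using (_≟_)
open import Data.Bool using (if_then_else_)
open import Data.Nat.ListAction using (sum)
open import Data.List using (List; []; _∷_; _++_; map; concatMap; length; upTo; zipWith; take; lookup; deduplicate)
open import Data.List.Membership.Propositional using (_∈_)
open import Data.Fin using (Fin; toℕ)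
open import Data.Product using (_×_; _,_; proj₁; proj₂)
open import Relation.Nullary using (¬_; yes; no)
open import Relation.Binary.PropositionalEquality using (_≡_)

-- Trees: every vertex carries its size |v| (in bytes) and an ordered
-- list of children.

data Tree : Set where
  node : ℕ → List Tree → Tree

kids : Tree → List Tree
kids (node _ ts) = ts

mutual
  height : Tree → ℕ
  height (node _ ts) = heights ts

  heights : List Tree → ℕ
  heights []       = 0
  heights (t ∷ ts) = suc (height t) ⊔ heights ts

mutual
  nverts : Tree → ℕ
  nverts (node _ ts) = suc (nvertsL ts)

  nvertsL : List Tree → ℕ
  nvertsL []       = 0
  nvertsL (t ∷ ts) = nverts t + nvertsL ts

-- A vertex of the tree T: its path from the root (list of child
-- indices) together with the subtree rooted at it.
record Vtx : Set where
  constructor vtx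
  field
    path : List ℕ
    sub  : Tree
open Vtx public

root : Tree → Vtx
root T = vtx [] T

vsize : Vtx → ℕ
vsize (vtx _ (node z _)) = z

childrenV : Vtx → List Vtx
childrenV (vtx p t) =
  zipWith (λ k c → vtx (p ++ (k ∷ [])) c) (upTo (length (kids t))) (kids t)

ChildOf : Vtx → Vtx → Set
ChildOf c p = c ∈ childrenV p

sizeL : List Vtx → ℕ
sizeL vs = sum (map vsize vs)

-- BFS_d(v) copies the levels 0..d (in BFS order) and
-- outputs the vertices that the next application has to start from.

level : ℕ → Vtx → List Vtx
level zero    v = v ∷ []
level (suc d) v = concatMap childrenV (level d v)

bfsCopies : ℕ → Vtx → List Vtx
bfsCopies d v = concatMap (λ e → level e v) (upTo (suc d))

-- least d (≤ height) with |BFS_d(v)| ≥ s; if the subtree is exhausted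
-- before reaching s, d = height (the whole subtree is copied).
findD : ℕ → (fuel d : ℕ) → Vtx → ℕ
findD s zero    d v = d
findD s (suc f) d v with s ≤? sizeL (bfsCopies d v)
... | yes _ = d
... | no  _ = findD s f (suc d) v

chooseD : ℕ → Vtx → ℕ
chooseD s v = findD s (height (sub v)) 0 v

-- Iterating an algorithm f : Vtx → (copies , output) on lists.
-- iterK f s fuel done xs performs rounds (applying f to each vertex of
-- the current list) until the total size processed reaches s, or the
-- list becomes empty.  It returns (all vertices f was called on, in
-- order ; final output list).

iterK : (Vtx → List Vtx × List Vtx) → ℕ → ℕ → ℕ → List Vtx → List Vtx × List Vtx
iterK f s zero    done xs       = ([] , xs)
iterK f s (suc k) done []       = ([] , [])
iterK f s (suc k) done (x ∷ xs) =
  if s ≤ᵇ done′ then (ys , o)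
  else (ys ++ proj₁ r , proj₂ r)
  where
  ys    = x ∷ xs
  done′ = done + sizeL (concatMap (λ y → proj₁ (f y)) ys)
  o     = concatMap (λ y → proj₂ (f y)) ys
  r     = iterK f s k done′ o

iterAll : (Vtx → List Vtx × List Vtx) → ℕ → List Vtx → List Vtx
iterAll f zero    xs       = []
iterAll f (suc k) []       = []
iterAll f (suc k) (x ∷ xs) = ys ++ iterAll f k (concatMap (λ y → proj₂ (f y)) ys)
  where ys = x ∷ xs

-- The algorithms P_j (block sizes s : ℕ → ℕ, s j = s_j for j ≥ 1).
-- P s j v = (list of copies made, in order ; output list).
-- P s 0 is junk and never used.

P′ : (ℕ → ℕ) → ℕ → Vtx → List Vtx × List Vtx
P′ s zero    v = (bfsCopies (chooseD (s 1) v) v , level (suc (chooseD (s 1) v)) v)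
P′ s (suc k) v =
  (concatMap (λ y → proj₁ (P′ s k y)) (proj₁ r) , proj₂ r)
  where r = iterK (P′ s k) (s (suc (suc k))) (nverts (sub v)) 0 (v ∷ [])

P : (ℕ → ℕ) → ℕ → Vtx → List Vtx × List Vtx
P s zero    v = ([] , [])
P s (suc k) v = P′ s k v

copies : (ℕ → ℕ) → ℕ → Vtx → List Vtx
copies s j v = proj₁ (P s j v)

-- the vertices on which P_j is called inside the call P_{j+1}(v)
subRoots : (ℕ → ℕ) → ℕ → Vtx → List Vtx
subRoots s (suc (suc j)) v =
  proj₁ (iterK (P′ s j) (s (suc (suc j))) (nverts (sub v)) 0 (v ∷ []))
subRoots s _ v = []

layoutRoots : (ℕ → ℕ) → ℕ → Tree → List Vtx
layoutRoots s n T = iterAll (P s n) (suc (nverts T)) (root T ∷ [])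

placed : ℕ → (Vtx → List Vtx) → List Vtx → List (Vtx × ℕ)
placed a f []       = []
placed a f (y ∷ ys) = (y , a) ∷ placed (a + sizeL (f y)) f ys

-- Occurs s n T a₀ j y a : during the layout of T (memory starting at
-- address a₀), the algorithm P_j is run on y, its copies starting at
-- address a.
data Occurs (s : ℕ → ℕ) (n : ℕ) (T : Tree) (a₀ : ℕ) : ℕ → Vtx → ℕ → Set where
  top : ∀ {y a} → (y , a) ∈ placed a₀ (copies s n) (layoutRoots s n T) →
        Occurs s n T a₀ n y a
  nested : ∀ {j y a z b} → Occurs s n T a₀ (suc j) y a →
        (z , b) ∈ placed a (copies s j) (subRoots s (suc j) y) →
        Occurs s n T a₀ j z b

-- Traversals inside the copied subtree C (list of copies of one call):
-- a downward path along tree edges (indices into C) ending at a leaf of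
-- the copied subtree (a copy with no child among the copies).

data DownPath (C : List Vtx) : Fin (length C) → List (Fin (length C)) → Set where
  leaf : ∀ {t} → (∀ u → ¬ ChildOf (lookup C u) (lookup C t)) →
         DownPath C t (t ∷ [])
  step : ∀ {t u ts} → ChildOf (lookup C u) (lookup C t) →
         DownPath C u ts → DownPath C t (t ∷ ts)

copyBytes : ℕ → (C : List Vtx) → Fin (length C) → List ℕ
copyBytes a C t = map (λ b → a + sizeL (take (toℕ t) C) + b) (upTo (vsize (lookup C t)))

-- index of the aligned block of size m containing byte b (m = 0 is junk)
blockOf : ℕ → ℕ → ℕ
blockOf zero    b = b
blockOf (suc m) b = b / suc m

numBlocks : ℕ → List ℕ → ℕ
numBlocks m bs = length (deduplicate _≟_ (map (blockOf m) bs))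

-- TravBound s n T a₀ i j B : every traversal that starts at the copy of x
-- made by a call P_i(x) of the layout and descends to a leaf of that
-- copied subtree accesses at most B level-j blocks (i.e. B = B_i^j works).
TravBound : (ℕ → ℕ) → ℕ → Tree → ℕ → ℕ → ℕ → ℕ → Set
TravBound s n T a₀ i j B =
  ∀ x a → Occurs s n T a₀ i x a →
  ∀ t ts → lookup (copies s i x) t ≡ x → DownPath (copies s i x) t ts →
  numBlocks (s j) (concatMap (copyBytes a (copies s i x)) ts) ≤ B

ValidBlockSizes : (ℕ → ℕ) → ℕ → Set
ValidBlockSizes s n = 1 ≤ s 1 × (∀ j → 1 ≤ j → j < n → s j < s (suc j))

-- P_{i+1}(x) runs P_i in rounds until the copies made reach s_{i+1} bytes.
-- The rounds before the last one copy fewer than s_{i+1} bytes, contiguously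
-- from the start of the call, so they meet at most two aligned blocks of size
-- s_{i+1}. Every call of P_i copies a piece of the tree: the top of the
-- subtree below its root, closed under children except for its output
-- vertices. For a call of the last round those are outputs of P_{i+1}(x),
-- hence not copied by it at all. So a downward traversal from x stays among
-- the early copies until it enters the copies of one call of the last round,
-- necessarily at that call's root, and then stays inside them down to a leaf;
-- by hypothesis that part meets at most B_i^{i+1} blocks.
module Submission where

open import Defs
open import Data.Bool using (true; false; if_then_else_; T)
open import Data.Empty using (⊥; ⊥-elim)
open import Data.Fin using (Fin; toℕ; zero; suc)
open import Data.List using (List; []; _∷_; _++_; _∷ʳ_; map; concatMap; length; upTo; zipWith; take; lookup; deduplicate)
open import Data.List.Membership.Propositional using (_∈_; find; lose)
open import Data.List.Membership.Propositional.Properties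
  using (∈-++⁺ˡ; ∈-++⁺ʳ; ∈-++⁻; ∈-map⁻; ∈-concatMap⁺; ∈-concatMap⁻; ∈-deduplicate⁻; ∈-deduplicate⁺; ∈-upTo⁻)
open import Data.List.Properties
  using (++-assoc; ++-identityʳ; length-++; map-++; concatMap-++; concatMap-pure; ∷-injective; ∷ʳ-injectiveˡ; ∷ʳ-injectiveʳ; upTo-∷ʳ)
open import Data.List.Relation.Unary.All using (All; []; _∷_)
import Data.List.Relation.Unary.All as All
import Data.List.Relation.Unary.All.Properties as All
open import Data.List.Relation.Unary.AllPairs using (AllPairs; []; _∷_)
import Data.List.Relation.Unary.AllPairs.Properties as AllPairs
open import Data.List.Relation.Binary.Subset.Propositional using (_⊆_)
open import Data.List.Relation.Binary.Subset.Propositional.Properties using (++⁺ʳ)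
open import Data.List.Relation.Unary.Any using (here; there)
open import Data.List.Relation.Unary.Unique.Propositional using (Unique)
open import Data.Nat using (ℕ; zero; suc; _+_; _∸_; _≤_; _<_; z≤n; s≤s; _≤ᵇ_; _/_; _<?_; _≤?_)
open import Data.Nat.DivMod using (/-monoˡ-≤; m/n≡1+[m∸n]/n)
open import Data.Nat.ListAction using (sum)
open import Data.Nat.ListAction.Properties using (sum-++)
open import Data.Nat.Properties
open import Data.List.Relation.Unary.Unique.DecPropositional.Properties _≟_ using (deduplicate-!)
open import Data.Product using (∃; _×_; _,_; proj₁; proj₂)
open import Data.Sum using (_⊎_; inj₁; inj₂)
open import Function using (_on_; _∘_)
open import Relation.Binary.Definitions using (Symmetric)
open import Relation.Binary.PropositionalEquality using (_≡_; _≢_; refl; sym; trans; cong; cong₂; subst; subst₂; module ≡-Reasoning)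
open import Relation.Nullary using (¬_; yes; no)

∈-concatMap⁻′ : ∀ {A B : Set} (f : A → List B) xs {w} → w ∈ concatMap f xs → ∃ λ y → y ∈ xs × w ∈ f y
∈-concatMap⁻′ f xs w∈ = find (∈-concatMap⁻ f w∈)

∈-concatMap⁺′ : ∀ {A B : Set} (f : A → List B) {xs y w} → y ∈ xs → w ∈ f y → w ∈ concatMap f xs
∈-concatMap⁺′ f y∈ w∈ = ∈-concatMap⁺ f (lose y∈ w∈)

AllPairs-∈ : ∀ {A : Set} {R : A → A → Set} → Symmetric R → ∀ {xs x y} →
             AllPairs R xs → x ∈ xs → y ∈ xs → x ≡ y ⊎ R x y
AllPairs-∈ sym-R (_ ∷ _)  (here refl) (here refl) = inj₁ refl
AllPairs-∈ sym-R (Rx ∷ _) (here refl) (there y∈) = inj₂ (All.lookup Rx y∈)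
AllPairs-∈ sym-R (Rx ∷ _) (there x∈) (here refl) = inj₂ (sym-R (All.lookup Rx x∈))
AllPairs-∈ sym-R (_ ∷ R)  (there x∈) (there y∈) = AllPairs-∈ sym-R R x∈ y∈

module _ {A : Set} where

  infix 4 _≼_ _∥_

  _≼_ : List A → List A → Set
  p ≼ q = ∃ λ r → p ++ r ≡ q

  _∥_ : List A → List A → Set
  p ∥ q = ¬ p ≼ q × ¬ q ≼ p

  ≼-refl : ∀ p → p ≼ p
  ≼-refl p = [] , ++-identityʳ p

  ≼-trans : ∀ {p q r} → p ≼ q → q ≼ r → p ≼ r
  ≼-trans {p} (a , refl) (b , refl) = a ++ b , sym (++-assoc p a b)

  ≼-comparable : ∀ {p q r} → p ≼ r → q ≼ r → p ≼ q ⊎ q ≼ p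
  ≼-comparable {[]}    {q}     _ _ = inj₁ (q , refl)
  ≼-comparable {a ∷ p} {[]}    _ _ = inj₂ (a ∷ p , refl)
  ≼-comparable {a ∷ p} {b ∷ q} (x , refl) (y , e) with ∷-injective e
  ... | refl , e′ with ≼-comparable {p} {q} (x , refl) (y , e′)
  ... | inj₁ (z , e″) = inj₁ (z , cong (a ∷_) e″)
  ... | inj₂ (z , e″) = inj₂ (z , cong (a ∷_) e″)

  ∥-sym : ∀ {p q} → p ∥ q → q ∥ p
  ∥-sym (p⋠q , q⋠p) = q⋠p , p⋠q

  ∥⇒no-common-extension : ∀ {p q r} → p ∥ q → p ≼ r → q ≼ r → ⊥
  ∥⇒no-common-extension (p⋠q , q⋠p) p≼r q≼r with ≼-comparable p≼r q≼r
  ... | inj₁ p≼q = p⋠q p≼q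
  ... | inj₂ q≼p = q⋠p q≼p

  ≼-length : ∀ {p q} → p ≼ q → length p ≤ length q
  ≼-length {p} (r , refl) = subst (length p ≤_) (sym (length-++ p)) (m≤m+n _ _)

  ≼∧length≡⇒≡ : ∀ {p q} → p ≼ q → length p ≡ length q → p ≡ q
  ≼∧length≡⇒≡ {p} ([] , e) _ = trans (sym (++-identityʳ p)) e
  ≼∧length≡⇒≡ {p} (x ∷ r , refl) eq = ⊥-elim (m≢1+n+m (length p) (trans eq (trans (length-++ p) (+-comm (length p) _))))

  ∷ʳ-≼-∷ʳ⇒≡ : ∀ p {k l} → p ∷ʳ k ≼ p ∷ʳ l → k ≡ l
  ∷ʳ-≼-∷ʳ⇒≡ p p≼ = ∷ʳ-injectiveʳ p p (≼∧length≡⇒≡ p≼ (trans (length-++ p) (sym (length-++ p))))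

  ∷ʳ-⋠ : ∀ p k → ¬ p ∷ʳ k ≼ p
  ∷ʳ-⋠ p k p≼ = <-irrefl refl (subst (_≤ length p) (trans (length-++ p) (+-comm (length p) 1)) (≼-length p≼))

∈-zipWith-∷ʳ : ∀ p ks (ts : List Tree) {c} → c ∈ zipWith (λ k t → vtx (p ∷ʳ k) t) ks ts →
               ∃ λ k → k ∈ ks × path c ≡ p ∷ʳ k
∈-zipWith-∷ʳ p (k ∷ ks) (t ∷ ts) (here refl) = k , here refl , refl
∈-zipWith-∷ʳ p (k ∷ ks) (t ∷ ts) (there c∈) with ∈-zipWith-∷ʳ p ks ts c∈
... | l , l∈ , e = l , there l∈ , e

zipWith-∷ʳ-antichain : ∀ p {ks} (ts : List Tree) → AllPairs _≢_ ks →
                       AllPairs (_∥_ on path) (zipWith (λ k t → vtx (p ∷ʳ k) t) ks ts)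
zipWith-∷ʳ-antichain p {[]}     _        _                 = []
zipWith-∷ʳ-antichain p {k ∷ ks} []       _                 = []
zipWith-∷ʳ-antichain p {k ∷ ks} (t ∷ ts) (k≢ks ∷ ks-dist) =
  All.tabulate sibling ∷ zipWith-∷ʳ-antichain p ts ks-dist
  where
  sibling : ∀ {c} → c ∈ zipWith _ _ ts → _
  sibling c∈ with ∈-zipWith-∷ʳ p _ ts c∈
  ... | l , l∈ , refl = (λ ≼l → All.lookup k≢ks l∈ (∷ʳ-≼-∷ʳ⇒≡ p ≼l))
                      , (λ l≼ → All.lookup k≢ks l∈ (sym (∷ʳ-≼-∷ʳ⇒≡ p l≼)))

ChildOf⇒∷ʳ : ∀ {c w} → ChildOf c w → ∃ λ k → path c ≡ path w ∷ʳ k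
ChildOf⇒∷ʳ {c} {vtx p t} c∈ with ∈-zipWith-∷ʳ p _ (kids t) c∈
... | k , _ , e = k , e

child-extends : ∀ {c w} → ChildOf c w → path w ≼ path c
child-extends {c} {w} ch with ChildOf⇒∷ʳ {c} {w} ch
... | k , e = k ∷ [] , sym e

child-⋠-parent : ∀ {c w} → ChildOf c w → ¬ path c ≼ path w
child-⋠-parent {c} {w} ch with ChildOf⇒∷ʳ {c} {w} ch
... | k , e = subst (λ q → ¬ q ≼ path w) (sym e) (∷ʳ-⋠ (path w) k)

parent-unique : ∀ {c w w′} → ChildOf c w → ChildOf c w′ → path w ≡ path w′
parent-unique {c} {w} {w′} ch ch′ with ChildOf⇒∷ʳ {c} {w} ch | ChildOf⇒∷ʳ {c} {w′} ch′
... | _ , e | _ , e′ = ∷ʳ-injectiveˡ _ _ (trans (sym e) e′)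

children-antichain : ∀ w → AllPairs (_∥_ on path) (childrenV w)
children-antichain (vtx p t) = zipWith-∷ʳ-antichain p (kids t)
  (AllPairs.applyUpTo⁺₁ (λ i → i) (length (kids t)) (λ i<j _ → <⇒≢ i<j))

-- The state of a top-down copying process started at v: the vertices cs
-- are copied, the vertices os are still to be expanded.
record Frontier (v : Vtx) (cs os : List Vtx) : Set where
  field
    copies-below       : ∀ {w} → w ∈ cs → path v ≼ path w
    frontier-below     : ∀ {o} → o ∈ os → path v ≼ path o
    copies-distinct    : AllPairs (_≢_ on path) cs
    frontier-antichain : AllPairs (_∥_ on path) os
    frontier-⋠-copies  : ∀ {o w} → o ∈ os → w ∈ cs → ¬ path o ≼ path w
    children-closed    : ∀ {w c} → w ∈ cs → ChildOf c w → c ∈ cs ⊎ c ∈ os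
    copy-parent        : ∀ {w} → w ∈ cs → w ≡ v ⊎ ∃ λ p → p ∈ cs × ChildOf w p
    frontier-parent    : ∀ {o} → o ∈ os → o ≡ v ⊎ ∃ λ p → p ∈ cs × ChildOf o p
open Frontier public

record Piece (v : Vtx) (cs os : List Vtx) : Set where
  field
    frontier    : Frontier v cs os
    root-copied : v ∈ cs
open Piece public

frontier-start : ∀ v → Frontier v [] (v ∷ [])
frontier-start v = record
  { copies-below       = λ ()
  ; frontier-below     = λ { (here refl) → ≼-refl (path v) }
  ; copies-distinct    = []
  ; frontier-antichain = [] ∷ []
  ; frontier-⋠-copies  = λ _ ()
  ; children-closed    = λ ()
  ; copy-parent        = λ ()
  ; frontier-parent    = λ { (here refl) → inj₁ refl }
  }

piece-frontier-parent : ∀ {v cs os o} → Piece v cs os → o ∈ os → ∃ λ p → p ∈ cs × ChildOf o p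
piece-frontier-parent P o∈ with frontier-parent (frontier P) o∈
... | inj₂ parent = parent
... | inj₁ refl   = ⊥-elim (frontier-⋠-copies (frontier P) o∈ (root-copied P) (≼-refl _))

if-elim : ∀ {A : Set} (P : A → Set) b {x y : A} → (b ≡ true → P x) → (b ≡ false → P y) → P (if b then x else y)
if-elim P true  on-true on-false = on-true refl
if-elim P false on-true on-false = on-false refl

sizeL-++ : ∀ xs ys → sizeL (xs ++ ys) ≡ sizeL xs + sizeL ys
sizeL-++ xs ys = trans (cong sum (map-++ vsize xs ys)) (sum-++ (map vsize xs) (map vsize ys))

module Iteration (f : Vtx → List Vtx × List Vtx) where

  copied out : Vtx → List Vtx
  copied y = proj₁ (f y)
  out    y = proj₂ (f y)

  iterK-starts-with : ∀ S k done x → ∃ λ rest → proj₁ (iterK f S (suc k) done (x ∷ [])) ≡ x ∷ rest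
  iterK-starts-with S k done x =
    if-elim (λ r → ∃ λ rest → proj₁ r ≡ x ∷ rest) (S ≤ᵇ (done + sizeL (concatMap copied (x ∷ []))))
      (λ _ → [] , refl) (λ _ → _ , refl)

  -- R₂ is the last round: the calls of the earlier rounds R₁ copy fewer
  -- than S bytes, and everything R₂ outputs is output by the iteration.
  iterK-last-round : ∀ S fuel done X → done < S →
    ∃ λ R₁ → ∃ λ R₂ → proj₁ (iterK f S fuel done X) ≡ R₁ ++ R₂
                    × done + sizeL (concatMap copied R₁) < S
                    × (∀ {y o} → y ∈ R₂ → o ∈ out y → o ∈ proj₂ (iterK f S fuel done X))
  iterK-last-round S zero    done X        done<S = [] , [] , refl , subst (_< S) (sym (+-identityʳ done)) done<S , λ ()
  iterK-last-round S (suc k) done []       done<S = [] , [] , refl , subst (_< S) (sym (+-identityʳ done)) done<S , λ ()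
  iterK-last-round S (suc k) done (x ∷ xs) done<S =
    if-elim (λ r → ∃ λ R₁ → ∃ λ R₂ → proj₁ r ≡ R₁ ++ R₂ × done + sizeL (concatMap copied R₁) < S
                                     × (∀ {y o} → y ∈ R₂ → o ∈ out y → o ∈ proj₂ r))
      (S ≤ᵇ done′)
      (λ _ → [] , x ∷ xs , refl , subst (_< S) (sym (+-identityʳ done)) done<S , ∈-concatMap⁺′ out)
      later
    where
    done′ = done + sizeL (concatMap copied (x ∷ xs))
    later : (S ≤ᵇ done′) ≡ false →
      ∃ λ R₁ → ∃ λ R₂ → (x ∷ xs) ++ proj₁ (iterK f S k done′ (concatMap out (x ∷ xs))) ≡ R₁ ++ R₂
                      × done + sizeL (concatMap copied R₁) < S
                      × (∀ {y o} → y ∈ R₂ → o ∈ out y → o ∈ proj₂ (iterK f S k done′ (concatMap out (x ∷ xs))))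
    later S≰done′ with iterK-last-round S k done′ (concatMap out (x ∷ xs))
                         (≰⇒> (λ S≤ → subst T S≰done′ (≤⇒≤ᵇ S≤)))
    ... | R₁ , R₂ , e , small , last =
      (x ∷ xs) ++ R₁ , R₂ , trans (cong ((x ∷ xs) ++_) e) (sym (++-assoc (x ∷ xs) R₁ R₂)) ,
      subst (_< S) total small , last
      where
      open ≡-Reasoning
      total : done′ + sizeL (concatMap copied R₁) ≡ done + sizeL (concatMap copied ((x ∷ xs) ++ R₁))
      total = begin
        done′ + sizeL (concatMap copied R₁)
          ≡⟨ +-assoc done _ _ ⟩
        done + (sizeL (concatMap copied (x ∷ xs)) + sizeL (concatMap copied R₁))
          ≡⟨ cong (done +_) (sym (sizeL-++ (concatMap copied (x ∷ xs)) _)) ⟩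
        done + sizeL (concatMap copied (x ∷ xs) ++ concatMap copied R₁)
          ≡⟨ cong (λ l → done + sizeL l) (sym (concatMap-++ copied (x ∷ xs) R₁)) ⟩
        done + sizeL (concatMap copied ((x ∷ xs) ++ R₁)) ∎

module Round (f : Vtx → List Vtx × List Vtx) (f-piece : ∀ v → Piece v (proj₁ (f v)) (proj₂ (f v))) where

  open Iteration f public

  private
    F : ∀ y → Frontier y (copied y) (out y)
    F y = frontier (f-piece y)

  calls-copies-distinct : ∀ {X} → AllPairs (_∥_ on path) X → AllPairs (_≢_ on path) (concatMap copied X)
  calls-copies-distinct {[]}    _             = []
  calls-copies-distinct {y ∷ X} (y∥X ∷ X-anti) =
    AllPairs.++⁺ (copies-distinct (F y)) (calls-copies-distinct X-anti)
                 (All.tabulate λ a∈ → All.tabulate λ b∈ → apart a∈ b∈)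
    where
    apart : ∀ {a b} → a ∈ copied y → b ∈ concatMap copied X → path a ≢ path b
    apart a∈ b∈ eq with ∈-concatMap⁻′ copied X b∈
    ... | y′ , y′∈ , b∈′ = ∥⇒no-common-extension (All.lookup y∥X y′∈) (copies-below (F y) a∈)
                             (subst (path y′ ≼_) (sym eq) (copies-below (F y′) b∈′))

  calls-frontier-antichain : ∀ {X} → AllPairs (_∥_ on path) X → AllPairs (_∥_ on path) (concatMap out X)
  calls-frontier-antichain {[]}    _              = []
  calls-frontier-antichain {y ∷ X} (y∥X ∷ X-anti) =
    AllPairs.++⁺ (frontier-antichain (F y)) (calls-frontier-antichain X-anti)
                 (All.tabulate λ a∈ → All.tabulate λ b∈ → apart a∈ b∈)
    where
    apart : ∀ {a b} → a ∈ out y → b ∈ concatMap out X → path a ∥ path b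
    apart a∈ b∈ with ∈-concatMap⁻′ out X b∈
    ... | y′ , y′∈ , b∈′ =
      (λ a≼b → ∥⇒no-common-extension y∥y′ (≼-trans (frontier-below (F y) a∈) a≼b) (frontier-below (F y′) b∈′)) ,
      (λ b≼a → ∥⇒no-common-extension y∥y′ (frontier-below (F y) a∈) (≼-trans (frontier-below (F y′) b∈′) b≼a))
      where y∥y′ = All.lookup y∥X y′∈

  module _ {v acc X} (J : Frontier v acc X) where

    private
      acc′ = acc ++ concatMap copied X

    round-copies-below : ∀ {w} → w ∈ acc′ → path v ≼ path w
    round-copies-below w∈ with ∈-++⁻ acc w∈
    ... | inj₁ w∈acc = copies-below J w∈acc
    ... | inj₂ w∈new with ∈-concatMap⁻′ copied X w∈new
    ... | y , y∈ , w∈y = ≼-trans (frontier-below J y∈) (copies-below (F y) w∈y)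

    round-frontier-below : ∀ {o} → o ∈ concatMap out X → path v ≼ path o
    round-frontier-below o∈ with ∈-concatMap⁻′ out X o∈
    ... | y , y∈ , o∈y = ≼-trans (frontier-below J y∈) (frontier-below (F y) o∈y)

    round-copies-distinct : AllPairs (_≢_ on path) acc′
    round-copies-distinct = AllPairs.++⁺ (copies-distinct J) (calls-copies-distinct (frontier-antichain J))
      (All.tabulate λ a∈ → All.tabulate λ b∈ → apart a∈ b∈)
      where
      apart : ∀ {a b} → a ∈ acc → b ∈ concatMap copied X → path a ≢ path b
      apart a∈ b∈ eq with ∈-concatMap⁻′ copied X b∈
      ... | y , y∈ , b∈y = frontier-⋠-copies J y∈ a∈ (subst (path y ≼_) (sym eq) (copies-below (F y) b∈y))

    round-frontier-⋠-copies : ∀ {o w} → o ∈ concatMap out X → w ∈ acc′ → ¬ path o ≼ path w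
    round-frontier-⋠-copies o∈ w∈ o≼w with ∈-concatMap⁻′ out X o∈
    ... | y , y∈ , o∈y with ∈-++⁻ acc w∈
    ... | inj₁ w∈acc = frontier-⋠-copies J y∈ w∈acc (≼-trans (frontier-below (F y) o∈y) o≼w)
    ... | inj₂ w∈new with ∈-concatMap⁻′ copied X w∈new
    ... | y′ , y′∈ , w∈y′ with AllPairs-∈ ∥-sym (frontier-antichain J) y∈ y′∈
    ... | inj₁ refl = frontier-⋠-copies (F y) o∈y w∈y′ o≼w
    ... | inj₂ y∥y′ = ∥⇒no-common-extension y∥y′ (≼-trans (frontier-below (F y) o∈y) o≼w) (copies-below (F y′) w∈y′)

    round-children-closed : ∀ {w c} → w ∈ acc′ → ChildOf c w → c ∈ acc′ ⊎ c ∈ concatMap out X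
    round-children-closed w∈ ch with ∈-++⁻ acc w∈
    ... | inj₁ w∈acc with children-closed J w∈acc ch
    ...   | inj₁ c∈acc = inj₁ (∈-++⁺ˡ c∈acc)
    ...   | inj₂ c∈X   = inj₁ (∈-++⁺ʳ acc (∈-concatMap⁺′ copied c∈X (root-copied (f-piece _))))
    round-children-closed w∈ ch | inj₂ w∈new with ∈-concatMap⁻′ copied X w∈new
    ... | y , y∈ , w∈y with children-closed (F y) w∈y ch
    ...   | inj₁ c∈y = inj₁ (∈-++⁺ʳ acc (∈-concatMap⁺′ copied y∈ c∈y))
    ...   | inj₂ c∈o = inj₂ (∈-concatMap⁺′ out y∈ c∈o)

    round-copy-parent : ∀ {w} → w ∈ acc′ → w ≡ v ⊎ ∃ λ p → p ∈ acc′ × ChildOf w p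
    round-copy-parent w∈ with ∈-++⁻ acc w∈
    ... | inj₁ w∈acc with copy-parent J w∈acc
    ...   | inj₁ w≡v              = inj₁ w≡v
    ...   | inj₂ (p , p∈ , ch)    = inj₂ (p , ∈-++⁺ˡ p∈ , ch)
    round-copy-parent w∈ | inj₂ w∈new with ∈-concatMap⁻′ copied X w∈new
    ... | y , y∈ , w∈y with copy-parent (F y) w∈y
    ...   | inj₂ (p , p∈ , ch)    = inj₂ (p , ∈-++⁺ʳ acc (∈-concatMap⁺′ copied y∈ p∈) , ch)
    ...   | inj₁ refl with frontier-parent J y∈
    ...     | inj₁ w≡v            = inj₁ w≡v
    ...     | inj₂ (p , p∈ , ch)  = inj₂ (p , ∈-++⁺ˡ p∈ , ch)

    round-frontier-parent : ∀ {o} → o ∈ concatMap out X → o ≡ v ⊎ ∃ λ p → p ∈ acc′ × ChildOf o p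
    round-frontier-parent o∈ with ∈-concatMap⁻′ out X o∈
    ... | y , y∈ , o∈y with piece-frontier-parent (f-piece y) o∈y
    ... | p , p∈ , ch = inj₂ (p , ∈-++⁺ʳ acc (∈-concatMap⁺′ copied y∈ p∈) , ch)

    round : Frontier v acc′ (concatMap out X)
    round = record
      { copies-below       = round-copies-below
      ; frontier-below     = round-frontier-below
      ; copies-distinct    = round-copies-distinct
      ; frontier-antichain = calls-frontier-antichain (frontier-antichain J)
      ; frontier-⋠-copies  = round-frontier-⋠-copies
      ; children-closed    = round-children-closed
      ; copy-parent        = round-copy-parent
      ; frontier-parent    = round-frontier-parent
      }

  iterK-frontier : ∀ {v} S fuel done X acc → Frontier v acc X →
    Frontier v (acc ++ concatMap copied (proj₁ (iterK f S fuel done X))) (proj₂ (iterK f S fuel done X))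
  iterK-frontier S zero    done X        acc J = subst₂ (Frontier _) (sym (++-identityʳ acc)) refl J
  iterK-frontier S (suc k) done []       acc J = subst₂ (Frontier _) (sym (++-identityʳ acc)) refl J
  iterK-frontier {v} S (suc k) done (x ∷ xs) acc J =
    if-elim (λ r → Frontier v (acc ++ concatMap copied (proj₁ r)) (proj₂ r))
      (S ≤ᵇ (done + sizeL (concatMap copied (x ∷ xs))))
      (λ _ → round J)
      (λ _ → subst₂ (Frontier v) (reassoc acc (x ∷ xs) _) refl
               (iterK-frontier S k _ (concatMap out (x ∷ xs)) (acc ++ concatMap copied (x ∷ xs)) (round J)))
    where
    reassoc : ∀ acc X Y → (acc ++ concatMap copied X) ++ concatMap copied Y ≡ acc ++ concatMap copied (X ++ Y)
    reassoc acc X Y = trans (++-assoc acc _ _) (cong (acc ++_) (sym (concatMap-++ copied X Y)))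

expand : Vtx → List Vtx × List Vtx
expand w = w ∷ [] , childrenV w

expand-piece : ∀ w → Piece w (w ∷ []) (childrenV w)
expand-piece w = record
  { frontier = record
    { copies-below       = λ { (here refl) → ≼-refl _ }
    ; frontier-below     = λ {o} o∈ → child-extends {o} {w} o∈
    ; copies-distinct    = [] ∷ []
    ; frontier-antichain = children-antichain w
    ; frontier-⋠-copies  = λ { {o} o∈ (here refl) → child-⋠-parent {o} {w} o∈ }
    ; children-closed    = λ { (here refl) ch → inj₂ ch }
    ; copy-parent        = λ { (here refl) → inj₁ refl }
    ; frontier-parent    = λ o∈ → inj₂ (w , here refl , o∈)
    }
  ; root-copied = here refl
  }

bfsCopies-suc : ∀ d v → bfsCopies (suc d) v ≡ bfsCopies d v ++ level (suc d) v
bfsCopies-suc d v = begin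
  concatMap (λ e → level e v) (upTo (suc (suc d)))
    ≡⟨ cong (concatMap (λ e → level e v)) (sym (upTo-∷ʳ (suc d))) ⟩
  concatMap (λ e → level e v) (upTo (suc d) ∷ʳ suc d)
    ≡⟨ concatMap-++ (λ e → level e v) (upTo (suc d)) (suc d ∷ []) ⟩
  bfsCopies d v ++ level (suc d) v ++ []
    ≡⟨ cong (bfsCopies d v ++_) (++-identityʳ _) ⟩
  bfsCopies d v ++ level (suc d) v ∎
  where open ≡-Reasoning

bfs-frontier : ∀ d v → Frontier v (bfsCopies d v) (level (suc d) v)
bfs-frontier zero    v = Round.round expand expand-piece (frontier-start v)
bfs-frontier (suc d) v = subst₂ (Frontier v)
  (trans (cong (bfsCopies d v ++_) (concatMap-pure (level (suc d) v))) (sym (bfsCopies-suc d v))) refl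
  (Round.round expand expand-piece (bfs-frontier d v))

P′-piece : ∀ s k v → Piece v (proj₁ (P′ s k v)) (proj₂ (P′ s k v))
P′-piece s zero    v = record { frontier = bfs-frontier (chooseD (s 1) v) v ; root-copied = here refl }
P′-piece s (suc k) v@(vtx _ (node _ ts)) = record
  { frontier    = iterK-frontier (s (suc (suc k))) (nverts (sub v)) 0 (v ∷ []) [] (frontier-start v)
  ; root-copied = root∈
  }
  where
  open Round (P′ s k) (P′-piece s k)
  root∈ : v ∈ concatMap copied (proj₁ (iterK (P′ s k) (s (suc (suc k))) (nverts (sub v)) 0 (v ∷ [])))
  root∈ with iterK-starts-with (s (suc (suc k))) (nvertsL ts) 0 v
  ... | rest , e = subst (λ R → v ∈ concatMap copied R) (sym e) (∈-++⁺ˡ (root-copied (P′-piece s k v)))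

blockOf-window : ∀ m a {r} → r < m → blockOf m (a + r) ∈ blockOf m a ∷ suc (blockOf m a) ∷ []
blockOf-window (suc m) a {r} r<m with (a + r) / suc m ≤? a / suc m
... | yes ≤q = here (≤-antisym ≤q (/-monoˡ-≤ (suc m) (m≤m+n a r)))
... | no  ≰q = there (here (≤-antisym ≤1+q (≰⇒> ≰q)))
  where
  open ≤-Reasoning
  ≤1+q : (a + r) / suc m ≤ suc (a / suc m)
  ≤1+q = begin
    (a + r) / suc m                   ≤⟨ /-monoˡ-≤ (suc m) (+-monoʳ-≤ a (<⇒≤ r<m)) ⟩
    (a + suc m) / suc m               ≡⟨ m/n≡1+[m∸n]/n (m≤n+m (suc m) a) ⟩
    suc ((a + suc m ∸ suc m) / suc m) ≡⟨ cong (λ z → suc (z / suc m)) (m+n∸n≡m a (suc m)) ⟩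
    suc (a / suc m)                   ∎

∈-removal : ∀ {A : Set} {x : A} {ys} → x ∈ ys →
            ∃ λ ys′ → length ys ≡ suc (length ys′) × (∀ {z} → z ∈ ys → z ≢ x → z ∈ ys′)
∈-removal {ys = y ∷ ys} (here refl) = ys , refl , λ { (here refl) z≢x → ⊥-elim (z≢x refl) ; (there z∈) _ → z∈ }
∈-removal {ys = y ∷ ys} (there x∈) with ∈-removal x∈
... | ys′ , e , keep = y ∷ ys′ , cong suc e , λ { (here refl) _ → here refl ; (there z∈) z≢x → there (keep z∈ z≢x) }

Unique∧⊆⇒length≤ : ∀ {A : Set} {xs ys : List A} → Unique xs → xs ⊆ ys → length xs ≤ length ys
Unique∧⊆⇒length≤ []                  _     = z≤n
Unique∧⊆⇒length≤ {xs = x ∷ xs} (x≢xs ∷ xs-unique) xs⊆ys with ∈-removal (xs⊆ys (here refl))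
... | ys′ , e , keep = subst (suc (length xs) ≤_) (sym e) (s≤s (Unique∧⊆⇒length≤ xs-unique xs⊆ys′))
  where
  xs⊆ys′ : xs ⊆ ys′
  xs⊆ys′ z∈ = keep (xs⊆ys (there z∈)) (λ z≡x → All.lookup x≢xs z∈ (sym z≡x))

deduplicate-length-≤ : ∀ {xs a b ys} → xs ⊆ a ∷ b ∷ ys →
                       length (deduplicate _≟_ xs) ≤ 2 + length (deduplicate _≟_ ys)
deduplicate-length-≤ {xs} {a} {b} xs⊆ = Unique∧⊆⇒length≤ (deduplicate-! xs)
  (++⁺ʳ (a ∷ b ∷ []) (∈-deduplicate⁺ _≟_) ∘ xs⊆ ∘ ∈-deduplicate⁻ _≟_ xs)

infix 4 _[_]=_

data _[_]=_ {A : Set} : List A → ℕ → A → Set where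
  at-zero : ∀ {x xs} → (x ∷ xs) [ 0 ]= x
  at-suc  : ∀ {x xs k y} → xs [ k ]= y → (x ∷ xs) [ suc k ]= y

module _ {A : Set} where

  lookup⇒[]= : ∀ (xs : List A) t → xs [ toℕ t ]= lookup xs t
  lookup⇒[]= (x ∷ xs) zero    = at-zero
  lookup⇒[]= (x ∷ xs) (suc t) = at-suc (lookup⇒[]= xs t)

  []=⇒lookup : ∀ {xs : List A} {k w} → xs [ k ]= w → ∃ λ t → toℕ t ≡ k × lookup xs t ≡ w
  []=⇒lookup at-zero = zero , refl , refl
  []=⇒lookup (at-suc at) with []=⇒lookup at
  ... | t , refl , e = suc t , refl , e

  []=⇒∈ : ∀ {xs : List A} {k w} → xs [ k ]= w → w ∈ xs
  []=⇒∈ at-zero     = here refl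
  []=⇒∈ (at-suc at) = there ([]=⇒∈ at)

  ∈⇒[]= : ∀ {xs : List A} {w} → w ∈ xs → ∃ λ k → xs [ k ]= w
  ∈⇒[]= (here refl) = 0 , at-zero
  ∈⇒[]= (there w∈) with ∈⇒[]= w∈
  ... | k , at = suc k , at-suc at

  []=⇒< : ∀ {xs : List A} {k w} → xs [ k ]= w → k < length xs
  []=⇒< at-zero     = s≤s z≤n
  []=⇒< (at-suc at) = s≤s ([]=⇒< at)

  []=-++⁺ˡ : ∀ {xs ys : List A} {k w} → xs [ k ]= w → xs ++ ys [ k ]= w
  []=-++⁺ˡ at-zero     = at-zero
  []=-++⁺ˡ (at-suc at) = at-suc ([]=-++⁺ˡ at)

  []=-++⁺ʳ : ∀ (xs : List A) {ys k w} → ys [ k ]= w → xs ++ ys [ length xs + k ]= w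
  []=-++⁺ʳ []       at = at
  []=-++⁺ʳ (x ∷ xs) at = at-suc ([]=-++⁺ʳ xs at)

  []=-++⁻ : ∀ (xs : List A) {ys k w} → xs ++ ys [ k ]= w →
            k < length xs × xs [ k ]= w ⊎ ∃ λ j → k ≡ length xs + j × ys [ j ]= w
  []=-++⁻ []       at          = inj₂ (_ , refl , at)
  []=-++⁻ (x ∷ xs) at-zero     = inj₁ (s≤s z≤n , at-zero)
  []=-++⁻ (x ∷ xs) (at-suc at) with []=-++⁻ xs at
  ... | inj₁ (k< , at′)       = inj₁ (s≤s k< , at-suc at′)
  ... | inj₂ (j , refl , at′) = inj₂ (j , refl , at′)

  []=-injective : ∀ {B : Set} {g : A → B} {xs k k′ w w′} → AllPairs (_≢_ on g) xs →
                  xs [ k ]= w → xs [ k′ ]= w′ → g w ≡ g w′ → k ≡ k′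
  []=-injective _          at-zero     at-zero      _ = refl
  []=-injective (g≢ ∷ _)   at-zero     (at-suc at′) e = ⊥-elim (All.lookup g≢ ([]=⇒∈ at′) e)
  []=-injective (g≢ ∷ _)   (at-suc at) at-zero      e = ⊥-elim (All.lookup g≢ ([]=⇒∈ at) (sym e))
  []=-injective (_ ∷ dist) (at-suc at) (at-suc at′) e = cong suc ([]=-injective dist at at′ e)

  take-++-≤ : ∀ (xs ys : List A) {k} → k ≤ length xs → take k (xs ++ ys) ≡ take k xs
  take-++-≤ xs       ys {zero}  _       = refl
  take-++-≤ (x ∷ xs) ys {suc k} (s≤s k≤) = cong (x ∷_) (take-++-≤ xs ys k≤)

  take-length-++ : ∀ (xs ys : List A) k → take (length xs + k) (xs ++ ys) ≡ xs ++ take k ys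
  take-length-++ []       ys k = refl
  take-length-++ (x ∷ xs) ys k = cong (x ∷_) (take-length-++ xs ys k)

[]=-concatMap⁻ : ∀ {A B : Set} (f : A → List B) R {k w} → concatMap f R [ k ]= w →
  ∃ λ Rₗ → ∃ λ y → ∃ λ Rᵣ → ∃ λ j → R ≡ Rₗ ++ y ∷ Rᵣ × k ≡ length (concatMap f Rₗ) + j × f y [ j ]= w
[]=-concatMap⁻ f (r ∷ R) at with []=-++⁻ (f r) at
... | inj₁ (_ , at′) = [] , r , R , _ , refl , refl , at′
... | inj₂ (j , refl , at′) with []=-concatMap⁻ f R at′
... | Rₗ , y , Rᵣ , i , refl , refl , at″ =
  r ∷ Rₗ , y , Rᵣ , i , refl , sym (trans (cong (_+ i) (length-++ (f r))) (+-assoc (length (f r)) _ i)) , at″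

[]=⇒sizeL-take+vsize≤ : ∀ {C k w} → C [ k ]= w → sizeL (take k C) + vsize w ≤ sizeL C
[]=⇒sizeL-take+vsize≤ {w ∷ C} at-zero     = m≤m+n (vsize w) (sizeL C)
[]=⇒sizeL-take+vsize≤ {x ∷ C} (at-suc at) =
  subst (_≤ vsize x + sizeL C) (sym (+-assoc (vsize x) _ _)) (+-monoʳ-≤ (vsize x) ([]=⇒sizeL-take+vsize≤ at))

copyBytesAt : ℕ → List Vtx → ℕ → Vtx → List ℕ
copyBytesAt a C k w = map (λ b → a + sizeL (take k C) + b) (upTo (vsize w))

pathBytes : ℕ → List Vtx → List (ℕ × Vtx) → List ℕ
pathBytes a C = concatMap (λ kw → copyBytesAt a C (proj₁ kw) (proj₂ kw))

-- DownPath with copies given by position and vertex instead of a Fin index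
-- into C, so that paths can be moved between C and its segments.
data DownPathAt (C : List Vtx) : ℕ → Vtx → List (ℕ × Vtx) → Set where
  leafAt : ∀ {k w} → (∀ {k′ c} → C [ k′ ]= c → ¬ ChildOf c w) → DownPathAt C k w ((k , w) ∷ [])
  stepAt : ∀ {k w k′ c ps} → C [ k′ ]= c → ChildOf c w → DownPathAt C k′ c ps → DownPathAt C k w ((k , w) ∷ ps)

positions : (C : List Vtx) → List (Fin (length C)) → List (ℕ × Vtx)
positions C = map (λ t → toℕ t , lookup C t)

DownPath⇒DownPathAt : ∀ {C t ts} → DownPath C t ts → DownPathAt C (toℕ t) (lookup C t) (positions C ts)
DownPath⇒DownPathAt {C} {t} (leaf no-child) = leafAt no-child′
  where
  no-child′ : ∀ {k c} → C [ k ]= c → ¬ ChildOf c (lookup C t)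
  no-child′ at with []=⇒lookup at
  ... | u , _ , refl = no-child u
DownPath⇒DownPathAt {C} (step {u = u} ch dp) = stepAt (lookup⇒[]= C u) ch (DownPath⇒DownPathAt dp)

copyBytes≡pathBytes : ∀ a C ts → concatMap (copyBytes a C) ts ≡ pathBytes a C (positions C ts)
copyBytes≡pathBytes a C []       = refl
copyBytes≡pathBytes a C (t ∷ ts) = cong (copyBytes a C t ++_) (copyBytes≡pathBytes a C ts)

DownPathAt⇒DownPath : ∀ {C k w ps} → C [ k ]= w → DownPathAt C k w ps →
  ∃ λ t → ∃ λ ts → lookup C t ≡ w × DownPath C t ts × (∀ b → concatMap (copyBytes b C) ts ≡ pathBytes b C ps)
DownPathAt⇒DownPath {C} at (leafAt no-child) with []=⇒lookup at
... | t , refl , refl = t , t ∷ [] , refl , leaf (λ u → no-child (lookup⇒[]= C u)) , λ _ → refl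
DownPathAt⇒DownPath {C} at (stepAt at′ ch dp) with []=⇒lookup at | DownPathAt⇒DownPath at′ dp
... | t , refl , refl | u , us , refl , dp′ , bytes =
  t , t ∷ us , refl , step ch dp′ , λ b → cong (copyBytes b C t ++_) (bytes b)

module Segment (Pre M Z : List Vtx) (a : ℕ)
  (distinct : AllPairs (_≢_ on path) (Pre ++ M ++ Z))
  (closed : ∀ {j w k c} → M [ j ]= w → ChildOf c w → Pre ++ M ++ Z [ k ]= c → c ∈ M) where

  copyBytesAt-shift : ∀ {j w} → M [ j ]= w →
    copyBytesAt a (Pre ++ M ++ Z) (length Pre + j) w ≡ copyBytesAt (a + sizeL Pre) M j w
  copyBytesAt-shift {j} {w} at = cong (λ base → map (base +_) (upTo (vsize w))) (begin
    a + sizeL (take (length Pre + j) (Pre ++ M ++ Z)) ≡⟨ cong (λ l → a + sizeL l) (take-length-++ Pre (M ++ Z) j) ⟩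
    a + sizeL (Pre ++ take j (M ++ Z))              ≡⟨ cong (λ l → a + sizeL (Pre ++ l)) (take-++-≤ M Z (<⇒≤ ([]=⇒< at))) ⟩
    a + sizeL (Pre ++ take j M)                     ≡⟨ cong (a +_) (sizeL-++ Pre (take j M)) ⟩
    a + (sizeL Pre + sizeL (take j M))              ≡⟨ +-assoc a _ _ ⟨
    a + sizeL Pre + sizeL (take j M)                ∎)
    where open ≡-Reasoning

  restrict : ∀ {j w ps} → M [ j ]= w → DownPathAt (Pre ++ M ++ Z) (length Pre + j) w ps →
    ∃ λ ps′ → DownPathAt M j w ps′ × pathBytes a (Pre ++ M ++ Z) ps ≡ pathBytes (a + sizeL Pre) M ps′
  restrict {j} {w} at (leafAt no-child) =
    (j , w) ∷ [] , leafAt (λ at′ → no-child ([]=-++⁺ʳ Pre ([]=-++⁺ˡ at′))) , cong (_++ []) (copyBytesAt-shift at)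
  restrict {j} {w} at (stepAt at-c ch dp) with ∈⇒[]= (closed at ch at-c)
  ... | j′ , at-c′ with []=-injective distinct at-c ([]=-++⁺ʳ Pre ([]=-++⁺ˡ at-c′)) refl
  ... | refl with restrict at-c′ dp
  ... | ps′ , dp′ , bytes = (j , w) ∷ ps′ , stepAt at-c′ ch dp′ , cong₂ _++_ (copyBytesAt-shift at) bytes

  restrict-traversal : ∀ {j w ps} → M [ j ]= w → DownPathAt (Pre ++ M ++ Z) (length Pre + j) w ps →
    ∃ λ t → ∃ λ ts → lookup M t ≡ w × DownPath M t ts
                   × pathBytes a (Pre ++ M ++ Z) ps ≡ concatMap (copyBytes (a + sizeL Pre) M) ts
  restrict-traversal at dp with restrict at dp
  ... | ps′ , dp′ , bytes with DownPathAt⇒DownPath at dp′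
  ... | t , ts , t↦w , dp″ , bytes′ = t , ts , t↦w , dp″ , trans bytes (sym (bytes′ (a + sizeL Pre)))

map-++-⊆ : ∀ {A B : Set} (f : A → B) {X Y Z} → map f X ⊆ Z → map f Y ⊆ Z → map f (X ++ Y) ⊆ Z
map-++-⊆ f {X} {Y} X⊆ Y⊆ z∈ with ∈-++⁻ (map f X) (subst (_ ∈_) (map-++ f X Y) z∈)
... | inj₁ z∈X = X⊆ z∈X
... | inj₂ z∈Y = Y⊆ z∈Y

TraversalBound : ℕ → List Vtx → ℕ → Vtx → ℕ → Set
TraversalBound m C a x B =
  ∀ t ts → lookup C t ≡ x → DownPath C t ts → numBlocks m (concatMap (copyBytes a C) ts) ≤ B

-- C₁ are the copies made by the early rounds of a call, R₂ the vertices on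
-- which the last round calls the lower level, cs y the copies of the call on y.
module LastRound (C₁ R₂ : List Vtx) (cs : Vtx → List Vtx) (a S B : ℕ) (x : Vtx)
  (distinct    : AllPairs (_≢_ on path) (C₁ ++ concatMap cs R₂))
  (call-parent : ∀ {y w} → y ∈ R₂ → w ∈ cs y → w ≡ y ⊎ ∃ λ p → p ∈ cs y × ChildOf w p)
  (call-closed : ∀ {y w c} → y ∈ R₂ → w ∈ cs y → ChildOf c w → c ∈ C₁ ++ concatMap cs R₂ → c ∈ cs y)
  (call-bound  : ∀ Rₗ y Rᵣ → R₂ ≡ Rₗ ++ y ∷ Rᵣ → TraversalBound S (cs y) (a + sizeL (C₁ ++ concatMap cs Rₗ)) y B)
  (C₁-small    : sizeL C₁ < S)
  (x-top       : ∀ {p} → p ∈ C₁ ++ concatMap cs R₂ → ¬ ChildOf x p) where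

  C : List Vtx
  C = C₁ ++ concatMap cs R₂

  q : ℕ
  q = blockOf S a

  record BlocksWithin (ps : List (ℕ × Vtx)) : Set where
    constructor blocksWithin
    field
      others    : List ℕ
      others-≤B : length (deduplicate _≟_ others) ≤ B
      blocks-⊆  : map (blockOf S) (pathBytes a C ps) ⊆ q ∷ suc q ∷ others

  early-copy-blocks : ∀ {k w D} → C [ k ]= w → k < length C₁ → map (blockOf S) (copyBytesAt a C k w) ⊆ q ∷ suc q ∷ D
  early-copy-blocks {k} {w} at k< z∈ with []=-++⁻ C₁ at
  ... | inj₂ (j , refl , _) = ⊥-elim (m+n≮m (length C₁) j k<)
  ... | inj₁ (_ , at₁) with ∈-map⁻ (blockOf S) z∈
  ... | _ , b′∈ , refl with ∈-map⁻ (λ b → a + sizeL (take k C) + b) b′∈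
  ... | b , b∈ , refl =
    ∈-++⁺ˡ (subst (λ z → blockOf S z ∈ q ∷ suc q ∷ []) (sym (+-assoc a _ b)) (blockOf-window S a offset<S))
    where
    open ≤-Reasoning
    offset<S : sizeL (take k C) + b < S
    offset<S = begin-strict
      sizeL (take k C) + b        ≡⟨ cong (λ l → sizeL l + b) (take-++-≤ C₁ _ (<⇒≤ k<)) ⟩
      sizeL (take k C₁) + b       <⟨ +-monoʳ-< _ (∈-upTo⁻ b∈) ⟩
      sizeL (take k C₁) + vsize w ≤⟨ []=⇒sizeL-take+vsize≤ at₁ ⟩
      sizeL C₁                    <⟨ C₁-small ⟩
      S                           ∎

  module Call {Rₗ y Rᵣ} (R₂≡ : R₂ ≡ Rₗ ++ y ∷ Rᵣ) where

    Pre Post : List Vtx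
    Pre  = C₁ ++ concatMap cs Rₗ
    Post = concatMap cs Rᵣ

    split : C ≡ Pre ++ cs y ++ Post
    split = trans (cong (λ R → C₁ ++ concatMap cs R) R₂≡)
                  (trans (cong (C₁ ++_) (concatMap-++ cs Rₗ (y ∷ Rᵣ))) (sym (++-assoc C₁ _ _)))

    y∈R₂ : y ∈ R₂
    y∈R₂ = subst (y ∈_) (sym R₂≡) (∈-++⁺ʳ Rₗ (here refl))

    closed : ∀ {j w k c} → cs y [ j ]= w → ChildOf c w → Pre ++ cs y ++ Post [ k ]= c → c ∈ cs y
    closed at-w ch at-c = call-closed y∈R₂ ([]=⇒∈ at-w) ch (subst (_ ∈_) (sym split) ([]=⇒∈ at-c))

    open Segment Pre (cs y) Post a (subst (AllPairs _) split distinct) closed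

    within-call : ∀ {j ps} → cs y [ j ]= y → DownPathAt C (length Pre + j) y ps → BlocksWithin ps
    within-call {ps = ps} at-y dp with restrict-traversal at-y (subst (λ L → DownPathAt L _ y ps) split dp)
    ... | t , ts , t↦y , dp-y , bytes = blocksWithin _ (call-bound Rₗ y Rᵣ R₂≡ t ts t↦y dp-y) ⊆-call
      where
      ⊆-call : map (blockOf S) (pathBytes a C ps) ⊆ q ∷ suc q ∷ map (blockOf S) (concatMap (copyBytes (a + sizeL Pre) (cs y)) ts)
      ⊆-call z∈ = there (there (subst (λ l → _ ∈ map (blockOf S) l) (trans (cong (λ L → pathBytes a L ps) split) bytes) z∈))

  enter-call : ∀ {k c ps} → C [ k ]= c → length C₁ ≤ k → (∀ {y} → y ∈ R₂ → c ∈ cs y → c ≡ y) →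
               DownPathAt C k c ps → BlocksWithin ps
  enter-call {ps = ps} at k≥ is-root dp with []=-++⁻ C₁ at
  ... | inj₁ (k< , _) = ⊥-elim (<⇒≱ k< k≥)
  ... | inj₂ (_ , refl , at₂) with []=-concatMap⁻ cs R₂ at₂
  ... | Rₗ , y , Rᵣ , j , R₂≡ , refl , at-y with is-root (Call.y∈R₂ R₂≡) ([]=⇒∈ at-y)
  ... | refl = Call.within-call R₂≡ at-y (subst (λ k → DownPathAt C k y ps) position dp)
    where
    position : length C₁ + (length (concatMap cs Rₗ) + j) ≡ length (C₁ ++ concatMap cs Rₗ) + j
    position = trans (sym (+-assoc (length C₁) _ j)) (cong (_+ j) (sym (length-++ C₁)))

  -- A child of an early copy lying among the copies of a call is that call's
  -- root: otherwise its parent in the call would be a second copy of the same vertex.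
  child-of-early-is-root : ∀ {k w c} → C [ k ]= w → k < length C₁ → ChildOf c w →
                           ∀ {y} → y ∈ R₂ → c ∈ cs y → c ≡ y
  child-of-early-is-root {k} {w} {c} at k< ch y∈ c∈ with call-parent y∈ c∈
  ... | inj₁ c≡y = c≡y
  ... | inj₂ (p , p∈ , ch′) with ∈⇒[]= (∈-concatMap⁺′ cs y∈ p∈)
  ... | m , at-p = ⊥-elim (m+n≮m (length C₁) m
        (subst (_< length C₁) ([]=-injective distinct at ([]=-++⁺ʳ C₁ at-p) (parent-unique {c} {w} {p} ch ch′)) k<))

  prepend-early : ∀ {k w ps} → C [ k ]= w → k < length C₁ → BlocksWithin ps → BlocksWithin ((k , w) ∷ ps)
  prepend-early at k< (blocksWithin D D≤B ⊆D) = blocksWithin D D≤B (map-++-⊆ (blockOf S) (early-copy-blocks at k<) ⊆D)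

  from-early : ∀ {k w ps} → C [ k ]= w → k < length C₁ → DownPathAt C k w ps → BlocksWithin ps
  from-early at k< (leafAt _) = prepend-early at k< (blocksWithin [] z≤n λ ())
  from-early at k< (stepAt {k′ = k′} at-c ch dp) with k′ <? length C₁
  ... | yes k′< = prepend-early at k< (from-early at-c k′< dp)
  ... | no  k′≮ = prepend-early at k< (enter-call at-c (≮⇒≥ k′≮) (child-of-early-is-root at k< ch) dp)

  traversal-blocks : ∀ t ts → lookup C t ≡ x → DownPath C t ts → BlocksWithin (positions C ts)
  traversal-blocks t ts t↦x dp with toℕ t <? length C₁
  ... | yes t< = from-early (lookup⇒[]= C t) t< (DownPath⇒DownPathAt dp)
  ... | no  t≮ = enter-call (lookup⇒[]= C t) (≮⇒≥ t≮) x-is-root (DownPath⇒DownPathAt dp)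
    where
    x-is-root : ∀ {y} → y ∈ R₂ → lookup C t ∈ cs y → lookup C t ≡ y
    x-is-root y∈ x∈ with call-parent y∈ x∈
    ... | inj₁ x≡y = x≡y
    ... | inj₂ (p , p∈ , ch) = ⊥-elim (x-top (∈-++⁺ʳ C₁ (∈-concatMap⁺′ cs y∈ p∈)) (subst (λ z → ChildOf z p) t↦x ch))

  last-round-bound : TraversalBound S C a x (2 + B)
  last-round-bound t ts t↦x dp with traversal-blocks t ts t↦x dp
  ... | blocksWithin D D≤B ⊆D = ≤-trans (deduplicate-length-≤ ⊆D′) (+-monoʳ-≤ 2 D≤B)
    where
    ⊆D′ : map (blockOf S) (concatMap (copyBytes a C) ts) ⊆ q ∷ suc q ∷ D
    ⊆D′ = ⊆D ∘ subst (λ l → _ ∈ map (blockOf S) l) (copyBytes≡pathBytes a C ts)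

placed-∈ : ∀ a (f : Vtx → List Vtx) Rₗ y Rᵣ → (y , a + sizeL (concatMap f Rₗ)) ∈ placed a f (Rₗ ++ y ∷ Rᵣ)
placed-∈ a f []       y Rᵣ = here (cong (y ,_) (+-identityʳ a))
placed-∈ a f (r ∷ Rₗ) y Rᵣ = there (subst (λ b → (y , b) ∈ placed (a + sizeL (f r)) f (Rₗ ++ y ∷ Rᵣ))
  (trans (+-assoc a _ _) (cong (a +_) (sym (sizeL-++ (f r) (concatMap f Rₗ))))) (placed-∈ (a + sizeL (f r)) f Rₗ y Rᵣ))

module _ (s : ℕ → ℕ) (j : ℕ) {x : Vtx} {a B : ℕ} where

  private
    S = s (suc (suc j))
    open Round (P′ s j) (P′-piece s j)
    whole = frontier (P′-piece s (suc j) x)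

  P-step-bound : 0 < S →
    (∀ {y b} → (y , b) ∈ placed a (copies s (suc j)) (subRoots s (suc (suc j)) x) →
               TraversalBound S (copies s (suc j) y) b y B) →
    TraversalBound S (copies s (suc (suc j)) x) a x (2 + B)
  P-step-bound S>0 sub-bound with iterK-last-round S (nverts (sub x)) 0 (x ∷ []) S>0
  ... | R₁ , R₂ , roots≡ , C₁-small , last-output =
    subst (λ C → TraversalBound S C a x (2 + B)) (sym copies≡) Last.last-round-bound
    where
    C₁ = concatMap copied R₁

    copies≡ : copies s (suc (suc j)) x ≡ C₁ ++ concatMap copied R₂
    copies≡ = trans (cong (concatMap copied) roots≡) (concatMap-++ copied R₁ R₂)

    in-copies : ∀ {c} → c ∈ C₁ ++ concatMap copied R₂ → c ∈ copies s (suc (suc j)) x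
    in-copies = subst (_ ∈_) (sym copies≡)

    call-closed : ∀ {y w c} → y ∈ R₂ → w ∈ copied y → ChildOf c w → c ∈ C₁ ++ concatMap copied R₂ → c ∈ copied y
    call-closed {y} y∈ w∈ ch c∈ with children-closed (frontier (P′-piece s j y)) w∈ ch
    ... | inj₁ c∈y   = c∈y
    ... | inj₂ c∈out = ⊥-elim (frontier-⋠-copies whole (last-output y∈ c∈out) (in-copies c∈) (≼-refl _))

    call-placed : ∀ Rₗ y Rᵣ → R₂ ≡ Rₗ ++ y ∷ Rᵣ →
      (y , a + sizeL (C₁ ++ concatMap copied Rₗ)) ∈ placed a copied (subRoots s (suc (suc j)) x)
    call-placed Rₗ y Rᵣ R₂≡ =
      subst₂ (λ R b → (y , a + sizeL b) ∈ placed a copied R)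
        (sym (trans roots≡ (trans (cong (R₁ ++_) R₂≡) (sym (++-assoc R₁ Rₗ (y ∷ Rᵣ))))))
        (concatMap-++ copied R₁ Rₗ)
        (placed-∈ a copied (R₁ ++ Rₗ) y Rᵣ)

    module Last = LastRound C₁ R₂ copied a S B x
      (subst (AllPairs _) copies≡ (copies-distinct whole))
      (λ _ w∈ → copy-parent (frontier (P′-piece s j _)) w∈)
      call-closed
      (λ Rₗ y Rᵣ R₂≡ → sub-bound (call-placed Rₗ y Rᵣ R₂≡))
      C₁-small
      (λ {p} p∈ ch → child-⋠-parent {x} {p} ch (copies-below whole (in-copies p∈)))

theorem1 : (s : ℕ → ℕ) (n : ℕ) (T : Tree) (a₀ : ℕ) → ValidBlockSizes s n →
    (i : ℕ) → 1 ≤ i → i < n → (B : ℕ) →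
    TravBound s n T a₀ i (1 + i) B → TravBound s n T a₀ (1 + i) (1 + i) (2 + B)
theorem1 s n T a₀ (_ , increasing) (suc j) (s≤s z≤n) i<n B bound x a occurs =
  P-step-bound s j (≤-<-trans z≤n (increasing (suc j) (s≤s z≤n) i<n))
    (λ y∈ → bound _ _ (nested occurs y∈))
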